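{- Let $\ast$ be an ergodic operation on a finite set $\mathcal{X}$. If $\mathcal{H}_1$ and $\mathcal{H}_2$ are stable partitions of $(\mathcal{X},\ast)$, then $\mathcal{H}_1\wedge\mathcal{H}_2$ is a stable partition of period at most $\mathrm{lcm}\{\mathrm{per}(\mathcal{H}_1),\mathrm{per}(\mathcal{H}_2)\}$.
   Context: $\ast$ is uniformity preserving if each map $x\mapsto x\ast b$ is bijective; ergodic if moreover there is $l>0$ such that for all $a,b$ there are $x_0,\dots,x_{l-1}$ with $(\cdots((a\ast x_0)\ast x_1)\cdots)\ast x_{l-1}=b$. For $A,B\subset\mathcal{X}$, $A\ast B=\{a\ast b\}$; $\mathcal{H}^{\ast}=\{A\ast B:A,B\in\mathcal{H}\}$, $\mathcal{H}^{0\ast}=\mathcal{H}$, $\mathcal{H}^{n\ast}=(\mathcal{H}^{(n-1)\ast})^{\ast}$. A partition is periodic if $\mathcal{H}^{n\ast}=\mathcal{H}$ for some $n>0$ (least such: $\mathrm{per}(\mathcal{H})$), balanced if all blocks have equal size, stable if balanced and periodic. $\mathcal{H}_1\wedge\mathcal{H}_2=\{H_1\cap H_2:H_1\in\mathcal{H}_1,H_2\in\mathcal{H}_2,H_1\cap H_2\neq\emptyset\}$. -}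

module Defs where

open import Data.Nat using (ℕ; zero; suc; _<_; _≤_)
open import Data.Fin using (Fin)
open import Data.Fin.Subset using (Subset; _∈_; _∩_; ∣_∣; Nonempty)
open import Data.List using (List; foldl; length)
open import Data.Product using (Σ; ∃; ∃-syntax; _×_)
open import Relation.Binary.PropositionalEquality using (_≡_)
open import Relation.Nullary using (¬_)
open import Function.Definitions using (Bijective)
open import Level using (0ℓ)

-- The finite set 𝒳 is modelled as Fin n; a binary operation on it:
Op : ℕ → Set
Op n = Fin n → Fin n → Fin n

UniformityPreserving : ∀ {n} → Op n → Set
UniformityPreserving {n} _∗_ = ∀ b → Bijective _≡_ _≡_ (λ x → x ∗ b)

Ergodic : ∀ {n} → Op n → Set
Ergodic {n} _∗_ = UniformityPreserving _∗_ ×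
  Σ ℕ λ l → (0 < l) × (∀ (a b : Fin n) →
    Σ (List (Fin n)) λ xs → (length xs ≡ l) × (foldl _∗_ a xs ≡ b))

Family : ℕ → Set₁
Family n = Subset n → Set

_≐_ : ∀ {n} → Family n → Family n → Set
F ≐ G = ∀ S → (F S → G S) × (G S → F S)

IsProduct : ∀ {n} → Op n → Subset n → Subset n → Subset n → Set
IsProduct _∗_ A B S =
  ∀ x → (x ∈ S → ∃[ a ] ∃[ b ] (a ∈ A × b ∈ B × (a ∗ b) ≡ x))
      × (∃[ a ] ∃[ b ] (a ∈ A × b ∈ B × (a ∗ b) ≡ x) → x ∈ S)

star : ∀ {n} → Op n → Family n → Family n
star _∗_ H S = ∃[ A ] ∃[ B ] (H A × H B × IsProduct _∗_ A B S)

starPow : ∀ {n} → Op n → ℕ → Family n → Family n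
starPow _∗_ zero    H = H
starPow _∗_ (suc k) H = star _∗_ (starPow _∗_ k H)

IsPartition : ∀ {n} → Family n → Set
IsPartition {n} H =
  (∀ S → H S → Nonempty S) ×
  (∀ (x : Fin n) → ∃[ S ] (H S × x ∈ S)) ×
  (∀ S T (x : Fin n) → H S → H T → x ∈ S → x ∈ T → S ≡ T)

Periodic : ∀ {n} → Op n → Family n → Set
Periodic _∗_ H = Σ ℕ λ k → (0 < k) × (starPow _∗_ k H ≐ H)

IsPeriod : ∀ {n} → Op n → Family n → ℕ → Set
IsPeriod _∗_ H p = (0 < p) × (starPow _∗_ p H ≐ H) ×
  (∀ q → 0 < q → q < p → ¬ (starPow _∗_ q H ≐ H))

Balanced : ∀ {n} → Family n → Set
Balanced H = ∀ S T → H S → H T → ∣ S ∣ ≡ ∣ T ∣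

Stable : ∀ {n} → Op n → Family n → Set
Stable _∗_ H = Balanced H × Periodic _∗_ H

_∧ₚ_ : ∀ {n} → Family n → Family n → Family n
(H₁ ∧ₚ H₂) S = ∃[ A ] ∃[ B ] (H₁ A × H₂ B × S ≡ A ∩ B × Nonempty (A ∩ B))

-- Right translations x ↦ x ∗ b are permutations, so |A ∗ B| ≥ |A ∗ b| = |A| whenever b ∈ B.
-- Along the powers ℋ^{j∗} of a stable partition block sizes therefore never drop, while at
-- multiples of the period they are back to the common block size of ℋ. Hence A ∗ B = A ∗ b for
-- A, B ∈ ℋ^{j∗} and b ∈ B, every ℋ^{j∗} is a partition, and ℋ^{(j+1)∗} = {A ∗ b : A ∈ ℋ^{j∗}}
-- for each fixed b. Translating by a common point d of C ∩ D then gives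
-- (A ∩ B) ∗ (C ∩ D) = (A ∗ d) ∩ (B ∗ d), so (ℋ₁ ∧ ℋ₂)^{j∗} = ℋ₁^{j∗} ∧ ℋ₂^{j∗}, which is ℋ₁ ∧ ℋ₂
-- again for j = lcm(per ℋ₁, per ℋ₂). Balance comes from ergodicity: translating a block along a
-- word that leads from one of its points to a point of another block, of length a multiple of
-- that lcm, keeps its size and ends in the other block. Everything is finite, so the least
-- period can be found by search.

module Submission where

open import Defs
open import Data.Nat using (ℕ; _≤_)
open import Data.Nat.LCM using (lcm)
open import Data.Product using (Σ; _×_)

open import Data.Bool using (Bool; if_then_else_) renaming (_≟_ to _≟ᵇ_)
open import Data.Empty using (⊥-elim)
open import Data.Fin using (Fin)
open import Data.Fin.Properties using (any?) renaming (_≟_ to _≟ᶠ_)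
open import Data.Fin.Permutation using (Permutation′; _⟨$⟩ʳ_; _⟨$⟩ˡ_; inverseˡ; inverseʳ; flip)
open import Data.Fin.Subset using (Subset; _∈_; _∩_; ∣_∣; Nonempty; _⊆_; inside; outside)
open import Data.Fin.Subset.Properties
  using (⊆-antisym; drop-∷-⊆; p⊆q⇒∣p∣≤∣q∣; x∈p∩q⁺; x∈p∩q⁻; _∈?_; nonempty?; anySubset?)
open import Data.List using ([]; _∷_; _++_; foldl; length)
open import Data.List.Properties using (foldl-++; length-++)
open import Data.Nat using (zero; suc; pred; s≤s⁻¹; _+_; _*_; _∸_; _<_; z≤n; s≤s; >-nonZero)
open import Data.Nat.Divisibility using (_∣_; divides)
open import Data.Nat.LCM using (gcd*lcm; m∣lcm[m,n]; n∣lcm[m,n])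
open import Data.Nat.GCD using (gcd)
open import Data.Nat.Properties
  using (+-0-commutativeMonoid; +-suc; *-comm; *-zeroʳ; m*n≡0⇒m≡0∨n≡0; n>0⇒n≢0; n≢0⇒n>0;
         suc-pred; m≤m*n; +-identityʳ; m<n⇒m<1+n; n<1+n; m∸n+n≡m; ≤-refl; ≤-trans; ≤-reflexive; <⇒≱; m<1+n⇒m<n∨m≡n)
open import Algebra.Properties.CommutativeMonoid.Sum +-0-commutativeMonoid
  using (sum; sum-cong-≗; sum-permute)
open import Data.Product using (∃; ∃-syntax; _,_; proj₁; proj₂)
open import Data.Sum using (_⊎_; inj₁; inj₂; [_,_]′)
open import Data.Vec using ([]; _∷_; lookup; tabulate; here)
open import Data.Vec.Properties using (lookup∘tabulate; []=⇒lookup; lookup⇒[]=; ≡-dec)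
open import Function using (_∘_; mk⤖)
open import Function.Properties.Bijection using (⤖⇒↔)
open import Relation.Binary.PropositionalEquality
open import Relation.Nullary using (¬_; Dec; yes; no; does)
open import Relation.Nullary.Decidable using (_×-dec_; _→-dec_; ¬?; decidable-stable; dec-true)
open import Relation.Unary using (Pred; Decidable)
open import Level using (0ℓ)

-- Subsets of Fin n

_≟ˢ_ : ∀ {n} → (p q : Subset n) → Dec (p ≡ q)
_≟ˢ_ = ≡-dec _≟ᵇ_

p⊆q∧∣q∣≤∣p∣⇒p≡q : ∀ {n} {p q : Subset n} → p ⊆ q → ∣ q ∣ ≤ ∣ p ∣ → p ≡ q
p⊆q∧∣q∣≤∣p∣⇒p≡q {p = []}          {[]}          _   _  = refl
p⊆q∧∣q∣≤∣p∣⇒p≡q {p = outside ∷ p} {outside ∷ q} p⊆q le =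
  cong (outside ∷_) (p⊆q∧∣q∣≤∣p∣⇒p≡q (drop-∷-⊆ p⊆q) le)
p⊆q∧∣q∣≤∣p∣⇒p≡q {p = inside ∷ p}  {inside ∷ q}  p⊆q le =
  cong (inside ∷_) (p⊆q∧∣q∣≤∣p∣⇒p≡q (drop-∷-⊆ p⊆q) (s≤s⁻¹ le))
p⊆q∧∣q∣≤∣p∣⇒p≡q {p = outside ∷ p} {inside ∷ q}  p⊆q le =
  ⊥-elim (<⇒≱ le (p⊆q⇒∣p∣≤∣q∣ (drop-∷-⊆ p⊆q)))
p⊆q∧∣q∣≤∣p∣⇒p≡q {p = inside ∷ p}  {outside ∷ q} p⊆q _  with () ← p⊆q here

∈-tabulate⁺ : ∀ {n} {f : Fin n → Bool} {x} → f x ≡ inside → x ∈ tabulate f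
∈-tabulate⁺ {f = f} {x} fx≡inside = lookup⇒[]= x (tabulate f) (trans (lookup∘tabulate f x) fx≡inside)

∈-tabulate⁻ : ∀ {n} {f : Fin n → Bool} {x} → x ∈ tabulate f → f x ≡ inside
∈-tabulate⁻ {f = f} {x} x∈ = trans (sym (lookup∘tabulate f x)) ([]=⇒lookup x∈)

module _ {n ℓ} {P : Pred (Fin n) ℓ} (P? : Decidable P) where

  subsetOf : Subset n
  subsetOf = tabulate (does ∘ P?)

  ∈-subsetOf⁺ : ∀ {x} → P x → x ∈ subsetOf
  ∈-subsetOf⁺ {x} px = ∈-tabulate⁺ (dec-true (P? x) px)

  ∈-subsetOf⁻ : ∀ {x} → x ∈ subsetOf → P x
  ∈-subsetOf⁻ {x} x∈ with P? x | ∈-tabulate⁻ {f = does ∘ P?} x∈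
  ... | yes px | _ = px
  ... | no _   | ()

indicator : Bool → ℕ
indicator b = if b then 1 else 0

∣p∣≡∑ : ∀ {n} (p : Subset n) → ∣ p ∣ ≡ sum (indicator ∘ lookup p)
∣p∣≡∑ []            = refl
∣p∣≡∑ (inside ∷ p)  = cong suc (∣p∣≡∑ p)
∣p∣≡∑ (outside ∷ p) = ∣p∣≡∑ p

module _ {n} (π : Permutation′ n) where

  image : Subset n → Subset n
  image p = tabulate (λ y → lookup p (π ⟨$⟩ˡ y))

  ⟨$⟩ˡ∈⇒∈-image : ∀ {p y} → π ⟨$⟩ˡ y ∈ p → y ∈ image p
  ⟨$⟩ˡ∈⇒∈-image π⁻¹y∈p = ∈-tabulate⁺ ([]=⇒lookup π⁻¹y∈p)

  ∈-image⁺ : ∀ {p x} → x ∈ p → π ⟨$⟩ʳ x ∈ image p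
  ∈-image⁺ {p} x∈p = ⟨$⟩ˡ∈⇒∈-image (subst (_∈ p) (sym (inverseˡ π)) x∈p)

  ∈-image⁻ : ∀ {p y} → y ∈ image p → π ⟨$⟩ˡ y ∈ p
  ∈-image⁻ {p} y∈ = lookup⇒[]= _ p (∈-tabulate⁻ y∈)

  ∣image∣ : ∀ p → ∣ image p ∣ ≡ ∣ p ∣
  ∣image∣ p = begin
    ∣ image p ∣                                  ≡⟨ ∣p∣≡∑ (image p) ⟩
    sum (indicator ∘ lookup (image p))           ≡⟨ sum-cong-≗ {n} (cong indicator ∘ lookup∘tabulate _) ⟩
    sum (λ y → indicator (lookup p (π ⟨$⟩ˡ y)))  ≡⟨ sum-permute (indicator ∘ lookup p) (flip π) ⟨
    sum (indicator ∘ lookup p)                   ≡⟨ ∣p∣≡∑ p ⟨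
    ∣ p ∣                                        ∎
    where open ≡-Reasoning

  image-∩ : ∀ p q → image (p ∩ q) ≡ image p ∩ image q
  image-∩ p q = ⊆-antisym
    (λ y∈ → let (yp , yq) = x∈p∩q⁻ p q (∈-image⁻ {p ∩ q} y∈)
            in x∈p∩q⁺ (⟨$⟩ˡ∈⇒∈-image {p} yp , ⟨$⟩ˡ∈⇒∈-image {q} yq))
    (λ y∈ → let (yp , yq) = x∈p∩q⁻ (image p) (image q) y∈
            in ⟨$⟩ˡ∈⇒∈-image {p ∩ q} (x∈p∩q⁺ (∈-image⁻ {p} yp , ∈-image⁻ {q} yq)))

  image-injective : ∀ {p q} → image p ≡ image q → p ≡ q
  image-injective eq = ⊆-antisym (transport eq) (transport (sym eq))
    where
    transport : ∀ {r s} → image r ≡ image s → r ⊆ s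
    transport {r} {s} eq {x} x∈r =
      subst (_∈ s) (inverseˡ π) (∈-image⁻ (subst (π ⟨$⟩ʳ x ∈_) eq (∈-image⁺ x∈r)))

-- Families of subsets

≐-refl : ∀ {n} {F : Family n} → F ≐ F
≐-refl S = (λ FS → FS) , (λ FS → FS)

≐-trans : ∀ {n} {F G K : Family n} → F ≐ G → G ≐ K → F ≐ K
≐-trans F≐G G≐K S = proj₁ (G≐K S) ∘ proj₁ (F≐G S) , proj₂ (F≐G S) ∘ proj₂ (G≐K S)

star-cong : ∀ {n} (_∗_ : Op n) {F G : Family n} → F ≐ G → star _∗_ F ≐ star _∗_ G
star-cong _∗_ F≐G S =
  (λ (A , B , FA , FB , P) → A , B , proj₁ (F≐G A) FA , proj₁ (F≐G B) FB , P) ,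
  (λ (A , B , GA , GB , P) → A , B , proj₂ (F≐G A) GA , proj₂ (F≐G B) GB , P)

starPow-cong : ∀ {n} (_∗_ : Op n) {F G : Family n} k → F ≐ G → starPow _∗_ k F ≐ starPow _∗_ k G
starPow-cong _∗_ zero    F≐G = F≐G
starPow-cong _∗_ (suc k) F≐G = star-cong _∗_ (starPow-cong _∗_ k F≐G)

starPow-+ : ∀ {n} (_∗_ : Op n) F i j → starPow _∗_ (i + j) F ≡ starPow _∗_ i (starPow _∗_ j F)
starPow-+ _∗_ F zero    j = refl
starPow-+ _∗_ F (suc i) j = cong (star _∗_) (starPow-+ _∗_ F i j)

starPow-periodic : ∀ {n} (_∗_ : Op n) {F} {k} → starPow _∗_ k F ≐ F →
                   ∀ c → starPow _∗_ (c * k) F ≐ F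
starPow-periodic _∗_         F^k≐F zero    = ≐-refl
starPow-periodic _∗_ {F} {k} F^k≐F (suc c) =
  subst (_≐ F) (sym (starPow-+ _∗_ F k (c * k)))
    (≐-trans (starPow-cong _∗_ k (starPow-periodic _∗_ F^k≐F c)) F^k≐F)

starPow-periodic-∣ : ∀ {n} (_∗_ : Op n) {F} {k m} → starPow _∗_ k F ≐ F → k ∣ m →
                     starPow _∗_ m F ≐ F
starPow-periodic-∣ _∗_ F^k≐F (divides c refl) = starPow-periodic _∗_ F^k≐F c

∧ₚ-cong : ∀ {n} {F F′ G G′ : Family n} → F ≐ F′ → G ≐ G′ → (F ∧ₚ G) ≐ (F′ ∧ₚ G′)
∧ₚ-cong F≐F′ G≐G′ S =
  (λ (A , B , FA , GB , eq , ne) → A , B , proj₁ (F≐F′ A) FA , proj₁ (G≐G′ B) GB , eq , ne) ,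
  (λ (A , B , FA , GB , eq , ne) → A , B , proj₂ (F≐F′ A) FA , proj₂ (G≐G′ B) GB , eq , ne)

isPartition-resp : ∀ {n} {F G : Family n} → F ≐ G → IsPartition G → IsPartition F
isPartition-resp F≐G (nonempty , cover , disjoint) =
  (λ S FS → nonempty S (proj₁ (F≐G S) FS)) ,
  (λ x → let (S , GS , x∈S) = cover x in S , proj₂ (F≐G S) GS , x∈S) ,
  (λ S T x FS FT → disjoint S T x (proj₁ (F≐G S) FS) (proj₁ (F≐G T) FT))

∧ₚ-isPartition : ∀ {n} {F G : Family n} → IsPartition F → IsPartition G → IsPartition (F ∧ₚ G)
∧ₚ-isPartition (_ , coverF , disjointF) (_ , coverG , disjointG) =
  (λ { S (A , B , _ , _ , refl , ne) → ne }) ,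
  (λ x → let (A , FA , x∈A) = coverF x ; (B , GB , x∈B) = coverG x
             x∈A∩B = x∈p∩q⁺ (x∈A , x∈B)
         in A ∩ B , (A , B , FA , GB , refl , (x , x∈A∩B)) , x∈A∩B) ,
  (λ { S T x (A , B , FA , GB , refl , _) (C , D , FC , GD , refl , _) x∈S x∈T →
       let (x∈A , x∈B) = x∈p∩q⁻ A B x∈S ; (x∈C , x∈D) = x∈p∩q⁻ C D x∈T
       in cong₂ _∩_ (disjointF A C x FA FC x∈A x∈C) (disjointG B D x GB GD x∈B x∈D) })

isPartition⇒decidable : ∀ {n} {F : Family n} → IsPartition F → Decidable F
isPartition⇒decidable (nonempty , cover , disjoint) S with nonempty? S
... | no ¬ne = no (λ FS → ¬ne (nonempty S FS))
... | yes (x , x∈S) with cover x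
...   | (T , FT , x∈T) with S ≟ˢ T
...     | yes refl = yes FT
...     | no S≢T   = no (λ FS → S≢T (disjoint S T x FS FT x∈S x∈T))

∀-subset? : ∀ {n ℓ} {P : Pred (Subset n) ℓ} → Decidable P → Dec (∀ S → P S)
∀-subset? P? with anySubset? (¬? ∘ P?)
... | yes (S , ¬PS) = no (λ ∀P → ¬PS (∀P S))
... | no ∄¬P        = yes (λ S → decidable-stable (P? S) (λ ¬PS → ∄¬P (S , ¬PS)))

≐-dec : ∀ {n} {F G : Family n} → IsPartition F → IsPartition G → Dec (F ≐ G)
≐-dec {F = F} {G} pF pG = ∀-subset? (λ S → (F? S →-dec G? S) ×-dec (G? S →-dec F? S))
  where
  F? : Decidable F
  F? = isPartition⇒decidable pF
  G? : Decidable G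
  G? = isPartition⇒decidable pG

-- Products and right translations

module Products {n} (_∗_ : Op n) where

  ProductOf : Subset n → Subset n → Pred (Fin n) 0ℓ
  ProductOf A B x = ∃[ a ] ∃[ b ] (a ∈ A × b ∈ B × a ∗ b ≡ x)

  productOf? : ∀ A B → Decidable (ProductOf A B)
  productOf? A B x = any? λ a → any? λ b → a ∈? A ×-dec b ∈? B ×-dec a ∗ b ≟ᶠ x

  _∗ₚ_ : Subset n → Subset n → Subset n
  A ∗ₚ B = subsetOf (productOf? A B)

  ∗ₚ-isProduct : ∀ A B → IsProduct _∗_ A B (A ∗ₚ B)
  ∗ₚ-isProduct A B x = ∈-subsetOf⁻ (productOf? A B) , ∈-subsetOf⁺ (productOf? A B)

  isProduct-unique : ∀ {A B S T} → IsProduct _∗_ A B S → IsProduct _∗_ A B T → S ≡ T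
  isProduct-unique PS PT =
    ⊆-antisym (λ {x} → proj₂ (PT x) ∘ proj₁ (PS x)) (λ {x} → proj₂ (PS x) ∘ proj₁ (PT x))

module RightTranslation {n} {_∗_ : Op n} (up : UniformityPreserving _∗_) where

  open Products _∗_ public

  ρ : Fin n → Permutation′ n
  ρ b = ⤖⇒↔ (mk⤖ (up b))

  _∗ᵣ_ : Subset n → Fin n → Subset n
  A ∗ᵣ b = image (ρ b) A

  _/_ : Fin n → Fin n → Fin n
  y / b = ρ b ⟨$⟩ˡ y

  /-∗ : ∀ y b → (y / b) ∗ b ≡ y
  /-∗ y b = inverseʳ (ρ b)

  ∈-∗ᵣ⁺ : ∀ {A x b} → x ∈ A → x ∗ b ∈ A ∗ᵣ b
  ∈-∗ᵣ⁺ {b = b} = ∈-image⁺ (ρ b)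

  ∈-∗ᵣ⁻ : ∀ {A y b} → y ∈ A ∗ᵣ b → y / b ∈ A
  ∈-∗ᵣ⁻ {b = b} = ∈-image⁻ (ρ b)

  /∈⇒∈-∗ᵣ : ∀ {A y b} → y / b ∈ A → y ∈ A ∗ᵣ b
  /∈⇒∈-∗ᵣ {b = b} = ⟨$⟩ˡ∈⇒∈-image (ρ b)

  ∣∗ᵣ∣ : ∀ A b → ∣ A ∗ᵣ b ∣ ≡ ∣ A ∣
  ∣∗ᵣ∣ A b = ∣image∣ (ρ b) A

  ∗ᵣ⊆product : ∀ {A B S b} → IsProduct _∗_ A B S → b ∈ B → A ∗ᵣ b ⊆ S
  ∗ᵣ⊆product {b = b} P b∈B {y} y∈ = proj₂ (P y) (y / b , b , ∈-∗ᵣ⁻ y∈ , b∈B , /-∗ y b)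

  ∣A∣≤∣A∗B∣ : ∀ {A B S b} → IsProduct _∗_ A B S → b ∈ B → ∣ A ∣ ≤ ∣ S ∣
  ∣A∣≤∣A∗B∣ {A} {b = b} P b∈B =
    ≤-trans (≤-reflexive (sym (∣∗ᵣ∣ A b))) (p⊆q⇒∣p∣≤∣q∣ (∗ᵣ⊆product P b∈B))

  isProduct-∩ : ∀ {A B C D d} → IsProduct _∗_ A C (A ∗ᵣ d) → IsProduct _∗_ B D (B ∗ᵣ d) →
                d ∈ C ∩ D → IsProduct _∗_ (A ∩ B) (C ∩ D) (A ∗ᵣ d ∩ B ∗ᵣ d)
  isProduct-∩ {A} {B} {C} {D} {d} PA PB d∈C∩D x =
    (λ x∈ → let (x∈A∗d , x∈B∗d) = x∈p∩q⁻ (A ∗ᵣ d) (B ∗ᵣ d) x∈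
            in x / d , d , x∈p∩q⁺ (∈-∗ᵣ⁻ x∈A∗d , ∈-∗ᵣ⁻ x∈B∗d) , d∈C∩D , /-∗ x d) ,
    (λ (a , c , a∈A∩B , c∈C∩D , ac≡x) →
       let (a∈A , a∈B) = x∈p∩q⁻ A B a∈A∩B ; (c∈C , c∈D) = x∈p∩q⁻ C D c∈C∩D
       in x∈p∩q⁺ (proj₂ (PA x) (a , c , a∈A , c∈C , ac≡x) ,
                  proj₂ (PB x) (a , c , a∈B , c∈D , ac≡x)))

-- Powers of a stable partition

module StablePartition {n} {_∗_ : Op n} (up : UniformityPreserving _∗_)
  {H : Family n} (H-isPartition : IsPartition H) (H-balanced : Balanced H)
  {k} (k>0 : 0 < k) (H-periodic : starPow _∗_ k H ≐ H) where

  open RightTranslation up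

  H^ : ℕ → Family n
  H^ j = starPow _∗_ j H

  H^[j*k]⊆H : ∀ j {S} → H^ (j * k) S → H S
  H^[j*k]⊆H j {S} = proj₁ (starPow-periodic _∗_ H-periodic j S)

  j≤j*k : ∀ j → j ≤ j * k
  j≤j*k j = m≤m*n j k {{>-nonZero k>0}}

  H^-nonempty : ∀ j {S} → H^ j S → Nonempty S
  H^-nonempty zero    {S} HS = proj₁ H-isPartition S HS
  H^-nonempty (suc j) (A , B , HA , HB , P) =
    let (a , a∈A) = H^-nonempty j HA ; (b , b∈B) = H^-nonempty j HB
    in a ∗ b , proj₂ (P (a ∗ b)) (a , b , a∈A , b∈B , refl)

  ∣H∣≤∣H^∣ : ∀ {A₀} → H A₀ → ∀ j {S} → H^ j S → ∣ A₀ ∣ ≤ ∣ S ∣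
  ∣H∣≤∣H^∣ HA₀ zero    {S} HS = ≤-reflexive (H-balanced _ S HA₀ HS)
  ∣H∣≤∣H^∣ HA₀ (suc j) (A , B , HA , HB , P) =
    ≤-trans (∣H∣≤∣H^∣ HA₀ j HA) (∣A∣≤∣A∗B∣ P (proj₂ (H^-nonempty j HB)))

  H^-grow : ∀ i j {S} → H^ j S → ∃[ T ] (H^ (i + j) T × ∣ S ∣ ≤ ∣ T ∣)
  H^-grow zero    j {S} HS = S , HS , ≤-refl
  H^-grow (suc i) j HS =
    let (T , HT , ∣S∣≤∣T∣) = H^-grow i j HS
    in T ∗ₚ T , (T , T , HT , HT , ∗ₚ-isProduct T T) ,
       ≤-trans ∣S∣≤∣T∣ (∣A∣≤∣A∗B∣ (∗ₚ-isProduct T T) (proj₂ (H^-nonempty (i + j) HT)))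

  -- Sizes cannot drop, and at the multiple j * k ≥ j they are back to those of the balanced H.
  ∣H^∣≤∣H∣ : ∀ {A₀} → H A₀ → ∀ j {S} → H^ j S → ∣ S ∣ ≤ ∣ A₀ ∣
  ∣H^∣≤∣H∣ {A₀} HA₀ j HS =
    let (T , HT , ∣S∣≤∣T∣) = H^-grow (j * k ∸ j) j HS
        HT′ = H^[j*k]⊆H j (subst (λ i → H^ i T) (m∸n+n≡m (j≤j*k j)) HT)
    in ≤-trans ∣S∣≤∣T∣ (≤-reflexive (H-balanced T A₀ HT′ HA₀))

  product≡∗ᵣ : ∀ j {A B S b} → H^ j A → H^ j B → IsProduct _∗_ A B S → b ∈ B → A ∗ᵣ b ≡ S
  product≡∗ᵣ j {A} {B} {S} {b} HA HB P b∈B =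
    let (a , a∈A) = H^-nonempty j HA
        (A₀ , HA₀ , _) = proj₁ (proj₂ H-isPartition) a
    in p⊆q∧∣q∣≤∣p∣⇒p≡q (∗ᵣ⊆product P b∈B) (begin
         ∣ S ∣       ≤⟨ ∣H^∣≤∣H∣ HA₀ (suc j) (A , B , HA , HB , P) ⟩
         ∣ A₀ ∣      ≤⟨ ∣H∣≤∣H^∣ HA₀ j HA ⟩
         ∣ A ∣       ≡⟨ ∣∗ᵣ∣ A b ⟨
         ∣ A ∗ᵣ b ∣  ∎)
    where open Data.Nat.Properties.≤-Reasoning

  isProduct-∗ᵣ : ∀ j {A B b} → H^ j A → H^ j B → b ∈ B → IsProduct _∗_ A B (A ∗ᵣ b)
  isProduct-∗ᵣ j {A} {B} HA HB b∈B =
    subst (IsProduct _∗_ A B) (sym (product≡∗ᵣ j HA HB (∗ₚ-isProduct A B) b∈B)) (∗ₚ-isProduct A B)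

  H^-cover : ∀ j x → ∃[ S ] (H^ j S × x ∈ S)
  H^-cover zero    x = proj₁ (proj₂ H-isPartition) x
  H^-cover (suc j) x =
    let (A , HA , x/x∈A) = H^-cover j (x / x)
        (B , HB , x∈B)   = H^-cover j x
    in A ∗ᵣ x , (A , B , HA , HB , isProduct-∗ᵣ j HA HB x∈B) , /∈⇒∈-∗ᵣ x/x∈A

  ∗ᵣ∈H^suc : ∀ j b {A} → H^ j A → H^ (suc j) (A ∗ᵣ b)
  ∗ᵣ∈H^suc j b {A} HA =
    let (B , HB , b∈B) = H^-cover j b in A , B , HA , HB , isProduct-∗ᵣ j HA HB b∈B

  Overlap : ℕ → Set
  Overlap j = ∃[ S ] ∃[ T ] ∃[ x ] (H^ j S × H^ j T × x ∈ S × x ∈ T × S ≢ T)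

  -- Translating by the common point x keeps both blocks and their overlap.
  overlap-suc : ∀ j → Overlap j → Overlap (suc j)
  overlap-suc j (S , T , x , HS , HT , x∈S , x∈T , S≢T) =
    S ∗ᵣ x , T ∗ᵣ x , x ∗ x , ∗ᵣ∈H^suc j x HS , ∗ᵣ∈H^suc j x HT ,
    ∈-∗ᵣ⁺ x∈S , ∈-∗ᵣ⁺ x∈T , S≢T ∘ image-injective (ρ x)

  overlap-+ : ∀ i j → Overlap j → Overlap (i + j)
  overlap-+ zero    j o = o
  overlap-+ (suc i) j o = overlap-suc (i + j) (overlap-+ i j o)

  H^-disjoint : ∀ j S T x → H^ j S → H^ j T → x ∈ S → x ∈ T → S ≡ T
  H^-disjoint j S T x HS HT x∈S x∈T with S ≟ˢ T
  ... | yes S≡T = S≡T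
  ... | no S≢T =
    let (S′ , T′ , y , HS′ , HT′ , y∈S′ , y∈T′ , S′≢T′) =
          subst Overlap (m∸n+n≡m (j≤j*k j))
            (overlap-+ (j * k ∸ j) j (S , T , x , HS , HT , x∈S , x∈T , S≢T))
    in ⊥-elim (S′≢T′ (proj₂ (proj₂ H-isPartition) S′ T′ y
                        (H^[j*k]⊆H j HS′) (H^[j*k]⊆H j HT′) y∈S′ y∈T′))

  H^-isPartition : ∀ j → IsPartition (H^ j)
  H^-isPartition j = (λ S → H^-nonempty j) , H^-cover j , H^-disjoint j

  H^suc⇒∗ᵣ : ∀ j b {S} → H^ (suc j) S → ∃[ A ] (H^ j A × S ≡ A ∗ᵣ b)
  H^suc⇒∗ᵣ j b {S} HS =
    let (y , y∈S) = H^-nonempty (suc j) HS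
        (A , HA , y/b∈A) = H^-cover j (y / b)
    in A , HA , H^-disjoint (suc j) S (A ∗ᵣ b) y HS (∗ᵣ∈H^suc j b HA) y∈S (/∈⇒∈-∗ᵣ y/b∈A)

-- Powers of the meet of two stable partitions

module Meet {n} {_∗_ : Op n} (up : UniformityPreserving _∗_) {H₁ H₂ : Family n}
  (H₁-isPartition : IsPartition H₁) (H₁-balanced : Balanced H₁)
  {k₁} (k₁>0 : 0 < k₁) (H₁-periodic : starPow _∗_ k₁ H₁ ≐ H₁)
  (H₂-isPartition : IsPartition H₂) (H₂-balanced : Balanced H₂)
  {k₂} (k₂>0 : 0 < k₂) (H₂-periodic : starPow _∗_ k₂ H₂ ≐ H₂) where

  open RightTranslation up
  module S₁ = StablePartition up H₁-isPartition H₁-balanced k₁>0 H₁-periodic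
  module S₂ = StablePartition up H₂-isPartition H₂-balanced k₂>0 H₂-periodic
  open S₁ using () renaming (H^ to H₁^)
  open S₂ using () renaming (H^ to H₂^)

  M^ : ℕ → Family n
  M^ j = starPow _∗_ j (H₁ ∧ₚ H₂)

  star-∧ₚ : ∀ j → star _∗_ (H₁^ j ∧ₚ H₂^ j) ≐ (H₁^ (suc j) ∧ₚ H₂^ (suc j))
  star-∧ₚ j _ = to , from
    where
    to : ∀ {S} → star _∗_ (H₁^ j ∧ₚ H₂^ j) S → (H₁^ (suc j) ∧ₚ H₂^ (suc j)) S
    to (_ , _ , (A , B , HA , HB , refl , (a , a∈A∩B)) , (C , D , HC , HD , refl , (d , d∈C∩D)) , P) =
      let (a∈A , a∈B) = x∈p∩q⁻ A B a∈A∩B ; (d∈C , d∈D) = x∈p∩q⁻ C D d∈C∩D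
          P′ = isProduct-∩ (S₁.isProduct-∗ᵣ j HA HC d∈C) (S₂.isProduct-∗ᵣ j HB HD d∈D) d∈C∩D
      in A ∗ᵣ d , B ∗ᵣ d , S₁.∗ᵣ∈H^suc j d HA , S₂.∗ᵣ∈H^suc j d HB , isProduct-unique P P′ ,
         (a ∗ d , x∈p∩q⁺ (∈-∗ᵣ⁺ a∈A , ∈-∗ᵣ⁺ a∈B))

    from : ∀ {S} → (H₁^ (suc j) ∧ₚ H₂^ (suc j)) S → star _∗_ (H₁^ j ∧ₚ H₂^ j) S
    from (E , F , HE , HF , refl , (y , y∈E∩F)) with S₁.H^suc⇒∗ᵣ j y HE | S₂.H^suc⇒∗ᵣ j y HF
    ... | A , HA , refl | B , HB , refl =
      let (y∈A∗y , y∈B∗y) = x∈p∩q⁻ (A ∗ᵣ y) (B ∗ᵣ y) y∈E∩F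
          (C , HC , y∈C) = S₁.H^-cover j y
          (D , HD , y∈D) = S₂.H^-cover j y
          y∈C∩D = x∈p∩q⁺ (y∈C , y∈D)
      in A ∩ B , C ∩ D ,
         (A , B , HA , HB , refl , (y / y , x∈p∩q⁺ (∈-∗ᵣ⁻ y∈A∗y , ∈-∗ᵣ⁻ y∈B∗y))) ,
         (C , D , HC , HD , refl , (y , y∈C∩D)) ,
         isProduct-∩ (S₁.isProduct-∗ᵣ j HA HC y∈C) (S₂.isProduct-∗ᵣ j HB HD y∈D) y∈C∩D

  M^≐ : ∀ j → M^ j ≐ (H₁^ j ∧ₚ H₂^ j)
  M^≐ zero    = ≐-refl
  M^≐ (suc j) = ≐-trans (star-cong _∗_ (M^≐ j)) (star-∧ₚ j)

  M^-isPartition : ∀ j → IsPartition (M^ j)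
  M^-isPartition j =
    isPartition-resp (M^≐ j) (∧ₚ-isPartition (S₁.H^-isPartition j) (S₂.H^-isPartition j))

  ∗ᵣ∈M^suc : ∀ j b {S} → M^ j S → M^ (suc j) (S ∗ᵣ b)
  ∗ᵣ∈M^suc j b {S} MS with proj₁ (M^≐ j S) MS
  ... | A , B , HA , HB , refl , (x , x∈A∩B) =
    proj₂ (M^≐ (suc j) ((A ∩ B) ∗ᵣ b))
      (A ∗ᵣ b , B ∗ᵣ b , S₁.∗ᵣ∈H^suc j b HA , S₂.∗ᵣ∈H^suc j b HB , image-∩ (ρ b) A B ,
       subst Nonempty (image-∩ (ρ b) A B) (x ∗ b , ∈-∗ᵣ⁺ x∈A∩B))

  M^-periodic : ∀ {m} → k₁ ∣ m → k₂ ∣ m → M^ m ≐ (H₁ ∧ₚ H₂)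
  M^-periodic {m} k₁∣m k₂∣m = ≐-trans (M^≐ m)
    (∧ₚ-cong (starPow-periodic-∣ _∗_ H₁-periodic k₁∣m) (starPow-periodic-∣ _∗_ H₂-periodic k₂∣m))

-- Ergodicity

module Ergodicity {n} {_∗_ : Op n} (up : UniformityPreserving _∗_) {l}
  (reach : ∀ a b → ∃[ xs ] (length xs ≡ l × foldl _∗_ a xs ≡ b)) where

  open RightTranslation up

  reach-multiple : ∀ c a b → ∃[ xs ] (length xs ≡ suc c * l × foldl _∗_ a xs ≡ b)
  reach-multiple zero    a b =
    let (xs , ∣xs∣≡l , a→b) = reach a b in xs , trans ∣xs∣≡l (sym (+-identityʳ l)) , a→b
  reach-multiple (suc c) a b =
    let (xs , ∣xs∣≡l , a→b) = reach a b
        (ys , ∣ys∣≡c*l , b→b) = reach-multiple c b b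
    in xs ++ ys ,
       trans (length-++ xs) (cong₂ _+_ ∣xs∣≡l ∣ys∣≡c*l) ,
       trans (foldl-++ _∗_ a xs ys) (trans (cong (λ z → foldl _∗_ z ys) a→b) b→b)

  module _ {F : Family n}
    (∗ᵣ∈F^suc : ∀ j b {S} → starPow _∗_ j F S → starPow _∗_ (suc j) F (S ∗ᵣ b)) where

    walk : ∀ xs j {S a} → starPow _∗_ j F S → a ∈ S →
           ∃[ T ] (starPow _∗_ (length xs + j) F T × foldl _∗_ a xs ∈ T × ∣ T ∣ ≡ ∣ S ∣)
    walk []       j {S} FS a∈S = S , FS , a∈S , refl
    walk (x ∷ xs) j {S} FS a∈S =
      let (T , FT , end∈T , ∣T∣≡∣S∗x∣) = walk xs (suc j) (∗ᵣ∈F^suc j x FS) (∈-∗ᵣ⁺ a∈S)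
      in T , subst (λ i → starPow _∗_ i F T) (+-suc (length xs) j) FT , end∈T ,
         trans ∣T∣≡∣S∗x∣ (∣∗ᵣ∣ S x)

    -- Walk a point of S to a point of T along a word of length l * L; since F^(l * L) = F,
    -- the block reached is T itself.
    periodic⇒balanced : IsPartition F → ∀ {L} → 0 < L → starPow _∗_ L F ≐ F → Balanced F
    periodic⇒balanced (nonempty , _ , disjoint) {L} L>0 F^L≐F S T FS FT =
      let (a , a∈S) = nonempty S FS
          (b , b∈T) = nonempty T FT
          (xs , ∣xs∣≡L*l , a→b) = reach-multiple (pred L) a b
          (T′ , F^T′ , end∈T′ , ∣T′∣≡∣S∣) = walk xs 0 FS a∈S
          FT′ = proj₁ (starPow-periodic _∗_ F^L≐F l T′)
                  (subst (λ i → starPow _∗_ i F T′) (index ∣xs∣≡L*l) F^T′)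
      in trans (sym ∣T′∣≡∣S∣)
           (cong ∣_∣ (disjoint T′ T b FT′ FT (subst (_∈ T′) a→b end∈T′) b∈T))
      where
      index : ∀ {m} → m ≡ suc (pred L) * l → m + 0 ≡ l * L
      index {m} m≡ = begin
        m + 0             ≡⟨ +-identityʳ m ⟩
        m                 ≡⟨ m≡ ⟩
        suc (pred L) * l  ≡⟨ cong (_* l) (suc-pred L {{>-nonZero L>0}}) ⟩
        L * l             ≡⟨ *-comm L l ⟩
        l * L             ∎
        where open ≡-Reasoning

searchBelow : ∀ {ℓ} {P : ℕ → Set ℓ} → Decidable P → ∀ m →
              (∃[ p ] (p < m × P p × ∀ q → q < p → ¬ P q)) ⊎ (∀ q → q < m → ¬ P q)
searchBelow P? zero = inj₂ (λ _ ())
searchBelow P? (suc m) with searchBelow P? m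
... | inj₁ (p , p<m , Pp , least) = inj₁ (p , m<n⇒m<1+n p<m , Pp , least)
... | inj₂ none with P? m
...   | yes Pm = inj₁ (m , n<1+n m , Pm , none)
...   | no ¬Pm = inj₂ (λ q q<1+m → [ none q , (λ { refl → ¬Pm }) ]′ (m<1+n⇒m<n∨m≡n q<1+m))

leastPositive : ∀ {ℓ} {P : ℕ → Set ℓ} → Decidable P → ∀ {m} → 0 < m → P m →
                ∃[ p ] ((0 < p × P p × (∀ q → 0 < q → q < p → ¬ P q)) × p ≤ m)
leastPositive P? {suc m} _ Pm with searchBelow (P? ∘ suc) (suc m)
... | inj₂ none = ⊥-elim (none m (n<1+n m) Pm)
... | inj₁ (p , p<1+m , Pp , least) =
  suc p , (s≤s z≤n , Pp , λ { (suc q) _ q<p → least q (s≤s⁻¹ q<p) }) , p<1+m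

lcm-positive : ∀ {m n} → 0 < m → 0 < n → 0 < lcm m n
lcm-positive {m} {n} m>0 n>0 = n≢0⇒n>0 λ lcm≡0 →
  [ n>0⇒n≢0 m>0 , n>0⇒n≢0 n>0 ]′ (m*n≡0⇒m≡0∨n≡0 m (begin
    m * n                ≡⟨ gcd*lcm m n ⟨
    gcd m n * lcm m n    ≡⟨ cong (gcd m n *_) lcm≡0 ⟩
    gcd m n * 0          ≡⟨ *-zeroʳ (gcd m n) ⟩
    0                    ∎))
  where open ≡-Reasoning

mainTheorem18 : ∀ {n} (_∗_ : Op n) → Ergodic _∗_ →
    (H₁ H₂ : Family n) →
    IsPartition H₁ → IsPartition H₂ →
    Stable _∗_ H₁ → Stable _∗_ H₂ →
    (p₁ p₂ : ℕ) → IsPeriod _∗_ H₁ p₁ → IsPeriod _∗_ H₂ p₂ →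
    IsPartition (H₁ ∧ₚ H₂) × Stable _∗_ (H₁ ∧ₚ H₂) ×
    Σ ℕ (λ p → IsPeriod _∗_ (H₁ ∧ₚ H₂) p × p ≤ lcm p₁ p₂)
mainTheorem18 _∗_ (up , _ , _ , reach) H₁ H₂ part₁ part₂ (bal₁ , _) (bal₂ , _)
    p₁ p₂ (p₁>0 , per₁ , _) (p₂>0 , per₂ , _) =
  M^-isPartition 0 , (balanced , L , L>0 , periodic) , leastPositive period? L>0 periodic
  where
  open Meet up part₁ bal₁ p₁>0 per₁ part₂ bal₂ p₂>0 per₂
  open Ergodicity up reach

  L : ℕ
  L = lcm p₁ p₂

  L>0 : 0 < L
  L>0 = lcm-positive p₁>0 p₂>0

  periodic : M^ L ≐ (H₁ ∧ₚ H₂)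
  periodic = M^-periodic (m∣lcm[m,n] p₁ p₂) (n∣lcm[m,n] p₁ p₂)

  balanced : Balanced (H₁ ∧ₚ H₂)
  balanced = periodic⇒balanced ∗ᵣ∈M^suc (M^-isPartition 0) L>0 periodic

  period? : Decidable (λ q → M^ q ≐ (H₁ ∧ₚ H₂))
  period? q = ≐-dec (M^-isPartition q) (M^-isPartition 0)
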